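{- For any $*$-term of the form $P\wedge Q$, the tree $se(P\wedge Q)$ has no candidate disjunction decomposition. Similarly, for any $*$-term of the form $P\vee Q$, the tree $se(P\vee Q)$ has no candidate conjunction decomposition.
   Context: Closed terms over constants $\mathsf T,\mathsf F$, atoms $a\in A$ ($A$ non-empty), unary $\neg$ and binary $\wedge,\vee$. Grammar (with $a\in A$): $P^{\mathsf T}::=\mathsf T\mid (a\wedge P^{\mathsf T})\vee P^{\mathsf T}$; $P^{\mathsf F}::=\mathsf F\mid (a\vee P^{\mathsf F})\wedge P^{\mathsf F}$; $\ell$-terms $P^\ell::=(a\wedge P^{\mathsf T})\vee P^{\mathsf F}\mid(\neg a\wedge P^{\mathsf T})\vee P^{\mathsf F}$; $*$-terms $P^*::=P^c\mid P^d$, $P^c::=P^\ell\mid P^*\wedge P^d$, $P^d::=P^\ell\mid P^*\vee P^c$ (so a $*$-term $P\wedge Q$ has $P\in P^*$, $Q\in P^d$, and a $*$-term $P\vee Q$ has $P\in P^*$, $Q\in P^c$). $\mathcal T_A$: least set containing $\mathsf T,\mathsf F$ and $X\trianglelefteq a\trianglerighteq Y$ for $X,Y\in\mathcal T_A$, $a\in A$; $\mathcal T_{A,\triangle}$ likewise with leaves in $\{\mathsf T,\mathsf F,\triangle\}$. Leaf replacement $X[\ell_1\mapsto Y_1,\dots]$ replaces every leaf $\ell_i$ of $X$ by $Y_i$. $se(\mathsf T)=\mathsf T$, $se(\mathsf F)=\mathsf F$, $se(a)=\mathsf T\trianglelefteq a\trianglerighteq\mathsf F$, $se(\neg P)=se(P)[\mathsf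 T\mapsto\mathsf F,\mathsf F\mapsto\mathsf T]$, $se(P\wedge Q)=se(P)[\mathsf T\mapsto se(Q)]$, $se(P\vee Q)=se(P)[\mathsf F\mapsto se(Q)]$. A pair $(Y,Z)\in\mathcal T_{A,\triangle}\times\mathcal T_A$ is a candidate conjunction decomposition of $X\in\mathcal T_A$ if $X=Y[\triangle\mapsto Z]$, $Y$ contains $\triangle$, $Y$ contains $\mathsf F$ but not $\mathsf T$, and $Z$ contains both $\mathsf T$ and $\mathsf F$. It is a candidate disjunction decomposition of $X$ if $X=Y[\triangle\mapsto Z]$, $Y$ contains $\triangle$, $Y$ contains $\mathsf T$ but not $\mathsf F$, and $Z$ contains both $\mathsf T$ and $\mathsf F$. -}

module Defs where

open import Data.Product using (Σ; _×_; _,_)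
open import Relation.Binary.PropositionalEquality using (_≡_)
open import Relation.Nullary using (¬_)

data Term (A : Set) : Set where
  `T `F : Term A
  atom  : A → Term A
  ¬'_   : Term A → Term A
  _∧'_  : Term A → Term A → Term A
  _∨'_  : Term A → Term A → Term A

infixr 6 _∧'_
infixr 5 _∨'_

module _ {A : Set} where

  data IsPT : Term A → Set where
    pT-T  : IsPT `T
    pT-or : ∀ {a P Q} → IsPT P → IsPT Q → IsPT ((atom a ∧' P) ∨' Q)

  data IsPF : Term A → Set where
    pF-F   : IsPF `F
    pF-and : ∀ {a P Q} → IsPF P → IsPF Q → IsPF ((atom a ∨' P) ∧' Q)

  data IsPℓ : Term A → Set where
    ℓ-pos : ∀ {a P Q} → IsPT P → IsPF Q → IsPℓ ((atom a ∧' P) ∨' Q)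
    ℓ-neg : ∀ {a P Q} → IsPT P → IsPF Q → IsPℓ (((¬' atom a) ∧' P) ∨' Q)

  data IsP* : Term A → Set
  data IsPc : Term A → Set
  data IsPd : Term A → Set

  data IsP* where
    *-c : ∀ {P} → IsPc P → IsP* P
    *-d : ∀ {P} → IsPd P → IsP* P

  data IsPc where
    c-ℓ   : ∀ {P} → IsPℓ P → IsPc P
    c-and : ∀ {P Q} → IsP* P → IsPd Q → IsPc (P ∧' Q)

  data IsPd where
    d-ℓ  : ∀ {P} → IsPℓ P → IsPd P
    d-or : ∀ {P Q} → IsP* P → IsPc Q → IsPd (P ∨' Q)

data Tree (A : Set) : Set where
  T F : Tree A
  node : Tree A → A → Tree A → Tree A   -- node X a Y  =  X ⊴ a ⊵ Y

data TreeΔ (A : Set) : Set where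
  TΔ FΔ △ : TreeΔ A
  nodeΔ : TreeΔ A → A → TreeΔ A → TreeΔ A

module _ {A : Set} where

  replTF : Tree A → Tree A → Tree A → Tree A
  replTF T y z = y
  replTF F y z = z
  replTF (node l a r) y z = node (replTF l y z) a (replTF r y z)

  repl△ : TreeΔ A → Tree A → Tree A
  repl△ TΔ z = T
  repl△ FΔ z = F
  repl△ △ z = z
  repl△ (nodeΔ l a r) z = node (repl△ l z) a (repl△ r z)

  se : Term A → Tree A
  se `T = T
  se `F = F
  se (atom a) = node T a F
  se (¬' P) = replTF (se P) F T
  se (P ∧' Q) = replTF (se P) (se Q) F
  se (P ∨' Q) = replTF (se P) T (se Q)

  data HasT : Tree A → Set where
    here : HasT T
    left : ∀ {l a r} → HasT l → HasT (node l a r)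
    right : ∀ {l a r} → HasT r → HasT (node l a r)

  data HasF : Tree A → Set where
    here : HasF F
    left : ∀ {l a r} → HasF l → HasF (node l a r)
    right : ∀ {l a r} → HasF r → HasF (node l a r)

  data HasTΔ : TreeΔ A → Set where
    here : HasTΔ TΔ
    left : ∀ {l a r} → HasTΔ l → HasTΔ (nodeΔ l a r)
    right : ∀ {l a r} → HasTΔ r → HasTΔ (nodeΔ l a r)

  data HasFΔ : TreeΔ A → Set where
    here : HasFΔ FΔ
    left : ∀ {l a r} → HasFΔ l → HasFΔ (nodeΔ l a r)
    right : ∀ {l a r} → HasFΔ r → HasFΔ (nodeΔ l a r)

  data Has△ : TreeΔ A → Set where
    here : Has△ △
    left : ∀ {l a r} → Has△ l → Has△ (nodeΔ l a r)
    right : ∀ {l a r} → Has△ r → Has△ (nodeΔ l a r)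

  CandConj : Tree A → TreeΔ A → Tree A → Set
  CandConj X Y Z =
    (X ≡ repl△ Y Z) × Has△ Y × HasFΔ Y × ¬ HasTΔ Y × HasT Z × HasF Z

  CandDisj : Tree A → TreeΔ A → Tree A → Set
  CandDisj X Y Z =
    (X ≡ repl△ Y Z) × Has△ Y × HasTΔ Y × ¬ HasFΔ Y × HasT Z × HasF Z

-- se (P ∧ Q) = S[T ↦ W] with S = se P and W = se Q both containing F.  In a candidate
-- disjunction decomposition S[T ↦ W] = Y[△ ↦ Z] every F leaf lies under a △ of Y; a △
-- above an F leaf of S lies inside S, so Z = S'[T ↦ W] with S' containing T, and W is a
-- subtree of Z.  But the T leaf of Y lies inside a copy of W, and the F leaves of that
-- copy lie under △s strictly below it, so Z is a proper subtree of W.  The disjunctive case of a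
-- *-term is dual (swap T and F); for an ℓ-term neither child of the root contains both
-- T and F, so no hole can cover a subtree containing both.
module Submission where

open import Defs
open import Data.Nat using (ℕ; suc; _+_; _≤_; _<_; s≤s)
open import Data.Nat.Properties using (≤-refl; ≤-trans; m≤m+n; m≤n+m; <⇒≤; <⇒≱)
open import Data.Product using (Σ; _×_; _,_; proj₁; proj₂; map)
open import Relation.Binary.PropositionalEquality using (_≡_; refl; cong₂; sym; trans)
open import Relation.Nullary using (¬_; contradiction)

module _ {A : Set} where

  Mixed : Tree A → Set
  Mixed X = HasT X × HasF X

  size : Tree A → ℕ
  size T = 1
  size F = 1
  size (node l _ r) = suc (size l + size r)

  data _⊑_ (Z : Tree A) : Tree A → Set where
    ⊑-refl  : Z ⊑ Z
    ⊑-left  : ∀ {l a r} → Z ⊑ l → Z ⊑ node l a r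
    ⊑-right : ∀ {l a r} → Z ⊑ r → Z ⊑ node l a r

  ⊑-size : ∀ {Z W} → Z ⊑ W → size Z ≤ size W
  ⊑-left-< : ∀ {Z l r : Tree A} {a} → Z ⊑ l → size Z < size (node l a r)
  ⊑-right-< : ∀ {Z l r : Tree A} {a} → Z ⊑ r → size Z < size (node l a r)
  ⊑-size ⊑-refl = ≤-refl
  ⊑-size (⊑-left {a = a} s) = <⇒≤ (⊑-left-< {a = a} s)
  ⊑-size (⊑-right {a = a} s) = <⇒≤ (⊑-right-< {a = a} s)
  ⊑-left-< {r = r} s = s≤s (≤-trans (⊑-size s) (m≤m+n _ (size r)))
  ⊑-right-< {l = l} s = s≤s (≤-trans (⊑-size s) (m≤n+m _ (size l)))

  ⊑-mixed : ∀ {Z W} → Z ⊑ W → Mixed Z → Mixed W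
  ⊑-mixed ⊑-refl m = m
  ⊑-mixed (⊑-left s) m = map left left (⊑-mixed s m)
  ⊑-mixed (⊑-right s) m = map right right (⊑-mixed s m)

  node-injective : ∀ {l r l′ r′ : Tree A} {a a′} → node l a r ≡ node l′ a′ r′ → l ≡ l′ × r ≡ r′
  node-injective refl = refl , refl

  ⊑-repl△-has△ : ∀ {Y Z} → Has△ Y → Z ⊑ repl△ Y Z
  ⊑-repl△-has△ here = ⊑-refl
  ⊑-repl△-has△ (left h) = ⊑-left (⊑-repl△-has△ h)
  ⊑-repl△-has△ (right h) = ⊑-right (⊑-repl△-has△ h)

  ⊑-repl△-hasF : ∀ Y {Z} → ¬ HasFΔ Y → HasF (repl△ Y Z) → Z ⊑ repl△ Y Z
  ⊑-repl△-hasF TΔ ¬fY ()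
  ⊑-repl△-hasF FΔ ¬fY _ = contradiction here ¬fY
  ⊑-repl△-hasF △ ¬fY _ = ⊑-refl
  ⊑-repl△-hasF (nodeΔ l _ r) ¬fY (left f) =
    ⊑-left (⊑-repl△-hasF l (λ x → ¬fY (left x)) f)
  ⊑-repl△-hasF (nodeΔ l _ r) ¬fY (right f) =
    ⊑-right (⊑-repl△-hasF r (λ x → ¬fY (right x)) f)

  repl△-hasF-strict : ∀ Y {Z} → HasTΔ Y → ¬ HasFΔ Y → HasF (repl△ Y Z) → size Z < size (repl△ Y Z)
  repl△-hasF-strict TΔ _ _ ()
  repl△-hasF-strict FΔ () _ _
  repl△-hasF-strict △ () _ _
  repl△-hasF-strict (nodeΔ l a r) _ ¬fY (left f) =
    ⊑-left-< {a = a} (⊑-repl△-hasF l (λ x → ¬fY (left x)) f)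
  repl△-hasF-strict (nodeΔ l a r) _ ¬fY (right f) =
    ⊑-right-< {a = a} (⊑-repl△-hasF r (λ x → ¬fY (right x)) f)

  ⊑-replT-hasT : ∀ S {W} → HasT (replTF S W F) → W ⊑ replTF S W F
  ⊑-replT-hasT T _ = ⊑-refl
  ⊑-replT-hasT F ()
  ⊑-replT-hasT (node l _ r) (left t) = ⊑-left (⊑-replT-hasT l t)
  ⊑-replT-hasT (node l _ r) (right t) = ⊑-right (⊑-replT-hasT r t)

  hole-over-F-replT : ∀ S {W Y Z} → HasF S → ¬ HasFΔ Y → replTF S W F ≡ repl△ Y Z →
                      Σ (Tree A) λ S′ → Z ≡ replTF S′ W F
  hole-over-F-replT S {Y = △} _ _ eq = S , sym eq
  hole-over-F-replT _ {Y = FΔ} _ ¬fY _ = contradiction here ¬fY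
  hole-over-F-replT F {Y = TΔ} here _ ()
  hole-over-F-replT F {Y = nodeΔ _ _ _} here _ ()
  hole-over-F-replT (node _ _ _) {Y = TΔ} _ _ ()
  hole-over-F-replT (node l _ r) {Y = nodeΔ _ _ _} (left f) ¬fY eq =
    hole-over-F-replT l f (λ x → ¬fY (left x)) (proj₁ (node-injective eq))
  hole-over-F-replT (node l _ r) {Y = nodeΔ _ _ _} (right f) ¬fY eq =
    hole-over-F-replT r f (λ x → ¬fY (right x)) (proj₂ (node-injective eq))

  hole-under-T-replT : ∀ S {W Y Z} → HasTΔ Y → ¬ HasFΔ Y → HasF W → replTF S W F ≡ repl△ Y Z →
                       size Z < size W
  hole-under-T-replT T {Y = Y} tY ¬fY fW refl = repl△-hasF-strict Y tY ¬fY fW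
  hole-under-T-replT F here _ _ ()
  hole-under-T-replT F (left _) _ _ ()
  hole-under-T-replT F (right _) _ _ ()
  hole-under-T-replT (node _ _ _) here _ _ ()
  hole-under-T-replT (node l _ r) (left tY) ¬fY fW eq =
    hole-under-T-replT l tY (λ x → ¬fY (left x)) fW (proj₁ (node-injective eq))
  hole-under-T-replT (node l _ r) (right tY) ¬fY fW eq =
    hole-under-T-replT r tY (λ x → ¬fY (right x)) fW (proj₂ (node-injective eq))

  noCandDisj-replT : ∀ S W → HasF S → HasF W → ∀ Y Z → ¬ CandDisj (replTF S W F) Y Z
  noCandDisj-replT S W fS fW Y Z (eq , _ , tY , ¬fY , tZ , _)
    with hole-over-F-replT S fS ¬fY eq
  ... | S′ , refl = <⇒≱ (hole-under-T-replT S tY ¬fY fW eq) (⊑-size (⊑-replT-hasT S′ tZ))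

  dual : Tree A → Tree A
  dual T = F
  dual F = T
  dual (node l a r) = node (dual l) a (dual r)

  dualΔ : TreeΔ A → TreeΔ A
  dualΔ TΔ = FΔ
  dualΔ FΔ = TΔ
  dualΔ △ = △
  dualΔ (nodeΔ l a r) = nodeΔ (dualΔ l) a (dualΔ r)

  dual-replTF : ∀ S {V W} → dual (replTF S V W) ≡ replTF (dual S) (dual W) (dual V)
  dual-replTF T = refl
  dual-replTF F = refl
  dual-replTF (node l a r) = cong₂ (λ l′ r′ → node l′ a r′) (dual-replTF l) (dual-replTF r)

  dual-repl△ : ∀ Y {Z} → dual (repl△ Y Z) ≡ repl△ (dualΔ Y) (dual Z)
  dual-repl△ TΔ = refl
  dual-repl△ FΔ = refl
  dual-repl△ △ = refl
  dual-repl△ (nodeΔ l a r) = cong₂ (λ l′ r′ → node l′ a r′) (dual-repl△ l) (dual-repl△ r)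

  hasT-dual : ∀ {X} → HasT X → HasF (dual X)
  hasT-dual here = here
  hasT-dual (left t) = left (hasT-dual t)
  hasT-dual (right t) = right (hasT-dual t)

  hasF-dual : ∀ {X} → HasF X → HasT (dual X)
  hasF-dual here = here
  hasF-dual (left f) = left (hasF-dual f)
  hasF-dual (right f) = right (hasF-dual f)

  has△-dualΔ : ∀ {Y} → Has△ Y → Has△ (dualΔ Y)
  has△-dualΔ here = here
  has△-dualΔ (left h) = left (has△-dualΔ h)
  has△-dualΔ (right h) = right (has△-dualΔ h)

  hasFΔ-dualΔ : ∀ {Y} → HasFΔ Y → HasTΔ (dualΔ Y)
  hasFΔ-dualΔ here = here
  hasFΔ-dualΔ (left f) = left (hasFΔ-dualΔ f)
  hasFΔ-dualΔ (right f) = right (hasFΔ-dualΔ f)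

  hasFΔ-dualΔ⁻ : ∀ Y → HasFΔ (dualΔ Y) → HasTΔ Y
  hasFΔ-dualΔ⁻ TΔ here = here
  hasFΔ-dualΔ⁻ (nodeΔ l _ r) (left f) = left (hasFΔ-dualΔ⁻ l f)
  hasFΔ-dualΔ⁻ (nodeΔ l _ r) (right f) = right (hasFΔ-dualΔ⁻ r f)

  candConj-dual : ∀ {X Y Z} → CandConj X Y Z → CandDisj (dual X) (dualΔ Y) (dual Z)
  candConj-dual {Y = Y} (refl , h , fY , ¬tY , tZ , fZ) =
    dual-repl△ Y , has△-dualΔ h , hasFΔ-dualΔ fY , (λ f → ¬tY (hasFΔ-dualΔ⁻ Y f)) ,
    hasF-dual fZ , hasT-dual tZ

  noCandConj-replF : ∀ S W → HasT S → HasT W → ∀ Y Z → ¬ CandConj (replTF S T W) Y Z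
  noCandConj-replF S W tS tW Y Z c with candConj-dual c
  ... | eq , rest =
    noCandDisj-replT (dual S) (dual W) (hasT-dual tS) (hasT-dual tW) (dualΔ Y) (dual Z)
      (trans (sym (dual-replTF S)) eq , rest)

  hasT-replTF : ∀ {S V W : Tree A} → HasT S → HasT V → HasT (replTF S V W)
  hasT-replTF here tV = tV
  hasT-replTF (left t) tV = left (hasT-replTF t tV)
  hasT-replTF (right t) tV = right (hasT-replTF t tV)

  hasF-replTF : ∀ {S V W : Tree A} → HasF S → HasF W → HasF (replTF S V W)
  hasF-replTF here fW = fW
  hasF-replTF (left f) fW = left (hasF-replTF f fW)
  hasF-replTF (right f) fW = right (hasF-replTF f fW)

  ¬hasT-replTF : ∀ (S : Tree A) {V W} → ¬ HasT S → ¬ HasT W → ¬ HasT (replTF S V W)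
  ¬hasT-replTF T ¬tS _ _ = ¬tS here
  ¬hasT-replTF F _ ¬tW t = ¬tW t
  ¬hasT-replTF (node l _ r) ¬tS ¬tW (left t) = ¬hasT-replTF l (λ x → ¬tS (left x)) ¬tW t
  ¬hasT-replTF (node l _ r) ¬tS ¬tW (right t) = ¬hasT-replTF r (λ x → ¬tS (right x)) ¬tW t

  ¬hasF-replTF : ∀ (S : Tree A) {V W} → ¬ HasF S → ¬ HasF V → ¬ HasF (replTF S V W)
  ¬hasF-replTF T _ ¬fV f = ¬fV f
  ¬hasF-replTF F ¬fS _ _ = ¬fS here
  ¬hasF-replTF (node l _ r) ¬fS ¬fV (left f) = ¬hasF-replTF l (λ x → ¬fS (left x)) ¬fV f
  ¬hasF-replTF (node l _ r) ¬fS ¬fV (right f) = ¬hasF-replTF r (λ x → ¬fS (right x)) ¬fV f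

  hasT-PT : ∀ {P : Term A} → IsPT P → HasT (se P)
  hasT-PT pT-T = here
  hasT-PT (pT-or _ q) = right (hasT-PT q)

  hasF-PF : ∀ {P : Term A} → IsPF P → HasF (se P)
  hasF-PF pF-F = here
  hasF-PF (pF-and _ q) = left (hasF-PF q)

  ¬hasF-PT : ∀ {P : Term A} → IsPT P → ¬ HasF (se P)
  ¬hasF-PT pT-T ()
  ¬hasF-PT (pT-or {P = P} p q) (left f) = ¬hasF-replTF (se P) (¬hasF-PT p) (λ ()) f
  ¬hasF-PT (pT-or p q) (right f) = ¬hasF-PT q f

  ¬hasT-PF : ∀ {P : Term A} → IsPF P → ¬ HasT (se P)
  ¬hasT-PF pF-F ()
  ¬hasT-PF (pF-and p q) (left t) = ¬hasT-PF q t
  ¬hasT-PF (pF-and {P = P} p q) (right t) = ¬hasT-replTF (se P) (¬hasT-PF p) (λ ()) t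

  mixed-ℓ : ∀ {P : Term A} → IsPℓ P → Mixed (se P)
  mixed-ℓ (ℓ-pos p q) = left (hasT-replTF (hasT-PT p) here) , right (hasF-PF q)
  mixed-ℓ (ℓ-neg p q) = right (hasT-replTF (hasT-PT p) here) , left (hasF-PF q)

  mixed-* : ∀ {P : Term A} → IsP* P → Mixed (se P)
  mixed-c : ∀ {P : Term A} → IsPc P → Mixed (se P)
  mixed-d : ∀ {P : Term A} → IsPd P → Mixed (se P)
  mixed-* (*-c c) = mixed-c c
  mixed-* (*-d d) = mixed-d d
  mixed-c (c-ℓ l) = mixed-ℓ l
  mixed-c (c-and p q) =
    hasT-replTF (proj₁ (mixed-* p)) (proj₁ (mixed-d q)) , hasF-replTF (proj₂ (mixed-* p)) here
  mixed-d (d-ℓ l) = mixed-ℓ l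
  mixed-d (d-or p q) =
    hasT-replTF (proj₁ (mixed-* p)) here , hasF-replTF (proj₂ (mixed-* p)) (proj₂ (mixed-c q))

  noCandConj-unmixed-children : ∀ {L R : Tree A} {a} → ¬ Mixed L → ¬ Mixed R →
                                ∀ Y Z → ¬ CandConj (node L a R) Y Z
  noCandConj-unmixed-children _ _ △ _ (_ , _ , () , _)
  noCandConj-unmixed-children _ _ TΔ _ (() , _)
  noCandConj-unmixed-children _ _ FΔ _ (() , _)
  noCandConj-unmixed-children ¬mL _ (nodeΔ _ _ _) _ (refl , left h , _ , _ , mZ) =
    ¬mL (⊑-mixed (⊑-repl△-has△ h) mZ)
  noCandConj-unmixed-children _ ¬mR (nodeΔ _ _ _) _ (refl , right h , _ , _ , mZ) =
    ¬mR (⊑-mixed (⊑-repl△-has△ h) mZ)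

  ¬mixed-replT-PT : ∀ {P : Term A} W → IsPT P → ¬ Mixed (replTF (se P) T W)
  ¬mixed-replT-PT {P} _ p (_ , f) = ¬hasF-replTF (se P) (¬hasF-PT p) (λ ()) f

  ¬mixed-PF : ∀ {P : Term A} → IsPF P → ¬ Mixed (se P)
  ¬mixed-PF q (t , _) = ¬hasT-PF q t

  -- se ((a ∧ P) ∨ Q) reduces to node (se P [F ↦ se Q]) a (se Q); with ¬ a the children swap.
  noCandConj-ℓ : ∀ {P : Term A} → IsPℓ P → ∀ Y Z → ¬ CandConj (se P) Y Z
  noCandConj-ℓ (ℓ-pos {Q = Q} p q) =
    noCandConj-unmixed-children (¬mixed-replT-PT (se Q) p) (¬mixed-PF q)
  noCandConj-ℓ (ℓ-neg {Q = Q} p q) =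
    noCandConj-unmixed-children (¬mixed-PF q) (¬mixed-replT-PT (se Q) p)

lemma3p5 : {A : Set} → A →
    (∀ (P Q : Term A) → IsP* (P ∧' Q) →
       ∀ (Y : TreeΔ A) (Z : Tree A) → ¬ CandDisj (se (P ∧' Q)) Y Z)
    × (∀ (P Q : Term A) → IsP* (P ∨' Q) →
       ∀ (Y : TreeΔ A) (Z : Tree A) → ¬ CandConj (se (P ∨' Q)) Y Z)
lemma3p5 {A} _ = conjunction , disjunction
  where
  conjunction : ∀ (P Q : Term A) → IsP* (P ∧' Q) → ∀ Y Z → ¬ CandDisj (se (P ∧' Q)) Y Z
  conjunction P Q (*-c (c-and p q)) =
    noCandDisj-replT (se P) (se Q) (proj₂ (mixed-* p)) (proj₂ (mixed-d q))
  conjunction P Q (*-c (c-ℓ ()))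
  conjunction P Q (*-d (d-ℓ ()))

  disjunction : ∀ (P Q : Term A) → IsP* (P ∨' Q) → ∀ Y Z → ¬ CandConj (se (P ∨' Q)) Y Z
  disjunction P Q (*-c (c-ℓ l)) = noCandConj-ℓ l
  disjunction P Q (*-d (d-ℓ l)) = noCandConj-ℓ l
  disjunction P Q (*-d (d-or p q)) =
    noCandConj-replF (se P) (se Q) (proj₁ (mixed-* p)) (proj₁ (mixed-c q))
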